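{- Let $V$ be a finite set and let $\ell,s,t,n\ge 2$ be integers satisfying $(t-1)(2\ell-1)\le n-1<t(2\ell-1)$. Let $V_1,V_2,\dots,V_s$ be subsets of $V$ such that (i) $V=V_1\cup V_2\cup\dots\cup V_s$; (ii) $|V_i|\le 2\ell-1$ for $i=1,\dots,s$; (iii) $|V\setminus V_i|\le n-1$ for $i=1,\dots,s$; (iv) $|V_1|+|V_2|+\dots+|V_s|\le |V|+s-1$. Then $$|V|\le \max\Big\{t(2\ell-1),\ n+\Big\lfloor\frac{n-1}{t}\Big\rfloor\Big\}.$$ -}

module Defs where

module Submission where

-- Counting argument bounding the size of a finite set V covered by s small,
-- "co-small" sets V₁,…,Vₛ with little overlap.  Write a = 2ℓ−1.
--
--  * Union bound: a cover gives |V| ≤ Σ|Vᵢ| ≤ s·a.  Hence if |V| > t·a then t < s,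
--    i.e. t ≤ s−1; otherwise |V| ≤ t·a and we are done.
--  * Each |V∖Vᵢ| ≤ n−1, so |Vᵢ| ≥ |V|−(n−1) =: y.  Summing and using (iv):
--    s·y ≤ Σ|Vᵢ| ≤ |V| + s − 1 ≤ (n−1) + y + (s−1), which rearranges to
--    (s−1)(y−1) ≤ n−1.  Since y−1 = |V|−n and t ≤ s−1, t·(|V|−n) ≤ n−1,
--    so |V| ≤ n + ⌊(n−1)/t⌋.

open import Defs
open import Data.Nat using (ℕ; NonZero; _+_; _*_; _∸_; _≤_; _<_; _⊔_; _/_; zero; suc; pred; z≤n; s≤s; s≤s⁻¹; _≤?_)
open import Data.Nat.Properties
open import Data.Nat.DivMod using (m*n/n≡m; /-monoˡ-≤)
open import Data.Nat.ListAction using (sum)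
open import Data.Nat.Solver using (module +-*-Solver)
open import Data.Fin using (Fin)
import Data.Fin as Fin
open import Data.Fin.Subset using (Subset; _∈_; _⊆_; ∣_∣; ∁; _∪_; ⊤; ⊥; ⋃; inside; outside)
open import Data.Fin.Subset.Properties using (∣∁p∣≡n∸∣p∣; ∣⊤∣≡n; ∣⊥∣≡0; ∣p∣≤∣x∷p∣; p⊆q⇒∣p∣≤∣q∣; p⊆p∪q; q⊆p∪q)
open import Data.List using (List; []; _∷_; map; tabulate)
open import Data.List.Properties using (map-tabulate)
open import Data.List.Membership.Propositional using () renaming (_∈_ to _∈ₗ_)
open import Data.List.Membership.Propositional.Properties using (∈-tabulate⁺)
open import Data.List.Relation.Unary.Any using (here; there)
open import Data.Vec using () renaming (_∷_ to _∷ᵥ_; [] to []ᵥ)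
open import Data.Product using (∃; _,_)
open import Relation.Binary.PropositionalEquality using (_≡_; refl; sym; cong)
open import Relation.Nullary using (yes; no)

∣p∪q∣≤∣p∣+∣q∣ : ∀ {n} (p q : Subset n) → ∣ p ∪ q ∣ ≤ ∣ p ∣ + ∣ q ∣
∣p∪q∣≤∣p∣+∣q∣ []ᵥ []ᵥ = z≤n
∣p∪q∣≤∣p∣+∣q∣ (inside ∷ᵥ p) (x ∷ᵥ q) =
  s≤s (≤-trans (∣p∪q∣≤∣p∣+∣q∣ p q) (+-monoʳ-≤ ∣ p ∣ (∣p∣≤∣x∷p∣ x q)))
∣p∪q∣≤∣p∣+∣q∣ (outside ∷ᵥ p) (inside ∷ᵥ q) =
  ≤-trans (s≤s (∣p∪q∣≤∣p∣+∣q∣ p q)) (≤-reflexive (sym (+-suc ∣ p ∣ ∣ q ∣)))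
∣p∪q∣≤∣p∣+∣q∣ (outside ∷ᵥ p) (outside ∷ᵥ q) = ∣p∪q∣≤∣p∣+∣q∣ p q

∣⋃ps∣≤sum : ∀ {n} (ps : List (Subset n)) → ∣ ⋃ ps ∣ ≤ sum (map ∣_∣ ps)
∣⋃ps∣≤sum {n} []  = ≤-reflexive (∣⊥∣≡0 n)
∣⋃ps∣≤sum (p ∷ ps) = ≤-trans (∣p∪q∣≤∣p∣+∣q∣ p (⋃ ps)) (+-monoʳ-≤ ∣ p ∣ (∣⋃ps∣≤sum ps))

∈-⋃ : ∀ {n} {x : Fin n} {p : Subset n} {ps : List (Subset n)} → x ∈ p → p ∈ₗ ps → x ∈ ⋃ ps
∈-⋃ x∈p (here refl)  = p⊆p∪q _ x∈p
∈-⋃ x∈p (there p∈ps) = q⊆p∪q _ _ (∈-⋃ x∈p p∈ps)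

cover⇒size≤sum : ∀ {m s} (V : Fin s → Subset m) → (∀ (x : Fin m) → ∃ λ (i : Fin s) → x ∈ V i) →
  m ≤ sum (tabulate (λ i → ∣ V i ∣))
cover⇒size≤sum {m} V covers = begin
  m                               ≡⟨ sym (∣⊤∣≡n m) ⟩
  ∣ ⊤ {m} ∣                       ≤⟨ p⊆q⇒∣p∣≤∣q∣ ⊤⊆⋃V ⟩
  ∣ ⋃ (tabulate V) ∣              ≤⟨ ∣⋃ps∣≤sum (tabulate V) ⟩
  sum (map ∣_∣ (tabulate V))      ≡⟨ cong sum (map-tabulate V ∣_∣) ⟩
  sum (tabulate (λ i → ∣ V i ∣))  ∎
  where
  open ≤-Reasoning
  ⊤⊆⋃V : ⊤ {m} ⊆ ⋃ (tabulate V)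
  ⊤⊆⋃V {x} _ with covers x
  ... | i , x∈Vi = ∈-⋃ x∈Vi (∈-tabulate⁺ i)

sum-mono : ∀ {s} (f g : Fin s → ℕ) → (∀ i → f i ≤ g i) → sum (tabulate f) ≤ sum (tabulate g)
sum-mono {zero}  f g f≤g = z≤n
sum-mono {suc s} f g f≤g =
  +-mono-≤ (f≤g Fin.zero) (sum-mono (λ i → f (Fin.suc i)) (λ i → g (Fin.suc i)) (λ i → f≤g (Fin.suc i)))

sum-const : ∀ s b → sum (tabulate (λ (_ : Fin s) → b)) ≡ s * b
sum-const zero    b = refl
sum-const (suc s) b = cong (b +_) (sum-const s b)

∣∁p∣≤k⇒n∸k≤∣p∣ : ∀ {n k} (p : Subset n) → ∣ ∁ p ∣ ≤ k → n ∸ k ≤ ∣ p ∣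
∣∁p∣≤k⇒n∸k≤∣p∣ {n} {k} p ∣∁p∣≤k = m≤n+o⇒m∸n≤o n k (begin
  n                    ≤⟨ m≤n+m∸n n ∣ p ∣ ⟩
  ∣ p ∣ + (n ∸ ∣ p ∣)  ≡⟨ cong (∣ p ∣ +_) (sym (∣∁p∣≡n∸∣p∣ p)) ⟩
  ∣ p ∣ + ∣ ∁ p ∣      ≤⟨ +-monoʳ-≤ ∣ p ∣ ∣∁p∣≤k ⟩
  ∣ p ∣ + k            ≡⟨ +-comm ∣ p ∣ k ⟩
  k + ∣ p ∣            ∎)
  where open ≤-Reasoning

excess-arith : ∀ s' n' y → suc s' * y ≤ n' + y + s' → s' * pred y ≤ n'
excess-arith s' n' zero    _ = ≤-trans (≤-reflexive (*-zeroʳ s')) z≤n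
excess-arith s' n' (suc x) h = +-cancelʳ-≤ (suc (x + s')) (s' * x) n' (begin
  s' * x + suc (x + s')  ≡⟨ reorder s' x ⟩
  suc s' * suc x         ≤⟨ h ⟩
  n' + suc x + s'        ≡⟨ +-assoc n' (suc x) s' ⟩
  n' + suc (x + s')      ∎)
  where
  open ≤-Reasoning
  open +-*-Solver
  reorder : ∀ s' x → s' * x + suc (x + s') ≡ suc s' * suc x
  reorder = solve 2 (λ s' x → s' :* x :+ (con 1 :+ (x :+ s')) := (con 1 :+ s') :* (con 1 :+ x)) refl

*≤⇒≤/ : ∀ {x k} t .{{_ : NonZero t}} → t * x ≤ k → x ≤ k / t
*≤⇒≤/ {x} {k} t tx≤k = begin
  x          ≡⟨ sym (m*n/n≡m x t) ⟩
  x * t / t  ≤⟨ /-monoˡ-≤ t (≤-trans (≤-reflexive (*-comm x t)) tx≤k) ⟩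
  k / t      ∎
  where open ≤-Reasoning

excess-bound : ∀ {m s' n'} t .{{_ : NonZero t}} → t ≤ s' → (V : Fin (suc s') → Subset m) →
  (∀ i → ∣ ∁ (V i) ∣ ≤ n') → sum (tabulate (λ i → ∣ V i ∣)) ≤ m + suc s' ∸ 1 →
  m ≤ suc n' + n' / t
excess-bound {m} {s'} {n'} t t≤s' V co-small total = begin
  m                      ≤⟨ m≤n+m∸n m (suc n') ⟩
  suc n' + (m ∸ suc n')  ≤⟨ +-monoʳ-≤ (suc n') (*≤⇒≤/ t excess) ⟩
  suc n' + n' / t        ∎
  where
  open ≤-Reasoning
  -- every Vᵢ has at least y = m − n' elements
  y = m ∸ n'
  counted : suc s' * y ≤ n' + y + s'
  counted = begin
    suc s' * y                                     ≡⟨ sym (sum-const (suc s') y) ⟩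
    sum (tabulate (λ (_ : Fin (suc s')) → y))      ≤⟨ sum-mono _ _ (λ i → ∣∁p∣≤k⇒n∸k≤∣p∣ (V i) (co-small i)) ⟩
    sum (tabulate (λ i → ∣ V i ∣))                 ≤⟨ total ⟩
    m + suc s' ∸ 1                                 ≡⟨ cong (_∸ 1) (+-suc m s') ⟩
    m + s'                                         ≤⟨ +-monoˡ-≤ s' (m≤n+m∸n m n') ⟩
    n' + y + s'                                    ∎
  excess : t * (m ∸ suc n') ≤ n'
  excess = begin
    t * (m ∸ suc n')   ≤⟨ *-monoˡ-≤ (m ∸ suc n') t≤s' ⟩
    s' * (m ∸ suc n')  ≡⟨ cong (s' *_) (sym (pred[m∸n]≡m∸[1+n] m n')) ⟩
    s' * pred y        ≤⟨ excess-arith s' n' y counted ⟩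
    n'                 ∎

lemma8 : (m ℓ s t n : ℕ) → 2 ≤ ℓ → 2 ≤ s → 2 ≤ t → 2 ≤ n → .{{_ : NonZero t}} →
    (t ∸ 1) * (2 * ℓ ∸ 1) ≤ n ∸ 1 → n ∸ 1 < t * (2 * ℓ ∸ 1) →
    (V : Fin s → Subset m) →
    (∀ (x : Fin m) → ∃ λ (i : Fin s) → x ∈ V i) →
    (∀ (i : Fin s) → ∣ V i ∣ ≤ 2 * ℓ ∸ 1) →
    (∀ (i : Fin s) → ∣ ∁ (V i) ∣ ≤ n ∸ 1) →
    sum (tabulate (λ (i : Fin s) → ∣ V i ∣)) ≤ m + s ∸ 1 →
    m ≤ t * (2 * ℓ ∸ 1) ⊔ (n + (n ∸ 1) / t)
lemma8 m ℓ (suc s') t (suc n') _ _ _ _ _ _ V covers small co-small total with m ≤? t * (2 * ℓ ∸ 1)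
... | yes m≤ta = m≤n⇒m≤n⊔o _ m≤ta
... | no  m≰ta = m≤n⇒m≤o⊔n _ (excess-bound t (s≤s⁻¹ t<s) V co-small total)
  where
  a = 2 * ℓ ∸ 1
  -- the union bound and |Vᵢ| ≤ a give t·a < m ≤ s·a, hence t < s
  t<s : t < suc s'
  t<s = *-cancelʳ-< a t (suc s') (<-≤-trans (≰⇒> m≰ta) (begin
    m                                          ≤⟨ cover⇒size≤sum V covers ⟩
    sum (tabulate (λ i → ∣ V i ∣))             ≤⟨ sum-mono _ _ small ⟩
    sum (tabulate (λ (_ : Fin (suc s')) → a))  ≡⟨ sum-const (suc s') a ⟩
    suc s' * a                                 ∎))
    where open ≤-Reasoning
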